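{- Let $T:\mathsf{Pre}\to\mathsf{Pre}$ be a locally monotone functor satisfying the Beck–Chevalley Condition, and let $\overline{T}:\mathsf{Rel}(\mathsf{Pre})\to\mathsf{Rel}(\mathsf{Pre})$ be its lifting (the 2-functor with $\overline{T}\circ(-)_\diamond=(-)_\diamond\circ T$). Then for every monotone map $f:\mathscr{A}\to\mathscr{B}$ of preorders, $\overline{T}(\ni_{\mathscr{A}})\cdot\overline{T}([f,\mathbb{2}]_\diamond)=\overline{T}((f^{op})^\diamond)\cdot\overline{T}(\ni_{\mathscr{B}})$ as relations from $T[\mathscr{B},\mathbb{2}]$ to $T(\mathscr{A}^{op})$.
   Context: $\mathscr{X}(x,x')\in\{0,1\}$ is the truth value of $x\le x'$; $\mathbb{2}=\{0\le1\}$. $\mathsf{Rel}(\mathsf{Pre})$: objects preorders; a monotone relation from $\mathscr{X}$ to $\mathscr{Y}$ is a monotone map $\mathscr{Y}^{op}\times\mathscr{X}\to\mathbb{2}$; composition $(S\cdot R)(z,x)=\bigvee_yR(y,x)\wedge S(z,y)$; 2-cells pointwise order. For monotone $h:\mathscr{X}\to\mathscr{Y}$: $h_\diamond(y,x)=\mathscr{Y}(y,hx)$ and $h^\diamond(x,y)=\mathscr{Y}(hx,y)$. $T$ is locally monotone if $f\le g$ implies $Tf\le Tg$; it satisfies the Beck–Chevalley Condition if it maps every exact lax square to an exact square, where a lax square $p_0:\mathscr{P}\to\mathscr{A}$, $p_1:\mathscr{P}\to\mathscr{B}$, $f:\mathscr{A}\to\mathscr{C}$, $g:\mathscr{B}\to\mathscr{C}$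 ($fp_0\le gp_1$) is exact iff $\mathscr{C}(fa,gb)=\bigvee_w\mathscr{A}(a,p_0w)\wedge\mathscr{B}(p_1w,b)$ for all $a,b$; such $T$ has a (unique) lifting $\overline{T}$. $[\mathscr{A},\mathbb{2}]$ is the poset of monotone maps $\mathscr{A}\to\mathbb{2}$ ordered pointwise; $[f,\mathbb{2}](V)=V\circ f$; $\ni_{\mathscr{A}}$ is the relation from $[\mathscr{A},\mathbb{2}]$ to $\mathscr{A}^{op}$ given by $\ni_{\mathscr{A}}(a,V)=V(a)$. -}

module Defs where

open import Data.Bool.Base using (Bool; true; false; f≤t; b≤b) renaming (_≤_ to _≤ᵇ_)
open import Data.Product using (Σ; _×_; _,_; proj₁; proj₂)
open import Relation.Binary.PropositionalEquality using (_≡_; refl)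

record Pre : Set₁ where
  field
    Carrier : Set
    _≤_     : Carrier → Carrier → Set
    ≤-refl  : ∀ {x} → x ≤ x
    ≤-trans : ∀ {x y z} → x ≤ y → y ≤ z → x ≤ z

∣_∣ : Pre → Set
∣ X ∣ = Pre.Carrier X

_⊢_≤_ : (X : Pre) → ∣ X ∣ → ∣ X ∣ → Set
X ⊢ x ≤ y = Pre._≤_ X x y

op : Pre → Pre
op X = record
  { Carrier = ∣ X ∣
  ; _≤_     = λ x y → X ⊢ y ≤ x
  ; ≤-refl  = Pre.≤-refl X
  ; ≤-trans = λ p q → Pre.≤-trans X q p }

record Mono (X Y : Pre) : Set where
  field
    fun  : ∣ X ∣ → ∣ Y ∣
    mono : ∀ {x x'} → X ⊢ x ≤ x' → Y ⊢ fun x ≤ fun x'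
open Mono public

idM : (X : Pre) → Mono X X
idM X = record { fun = λ x → x ; mono = λ p → p }

_∘M_ : ∀ {X Y Z} → Mono Y Z → Mono X Y → Mono X Z
g ∘M f = record { fun = λ x → fun g (fun f x) ; mono = λ p → mono g (mono f p) }

_≤M_ : ∀ {X Y} → Mono X Y → Mono X Y → Set
_≤M_ {X} {Y} f g = ∀ x → Y ⊢ fun f x ≤ fun g x

opM : ∀ {A B} → Mono A B → Mono (op A) (op B)
opM f = record { fun = fun f ; mono = mono f }

𝟚 : Pre
𝟚 = record
  { Carrier = Bool
  ; _≤_     = _≤ᵇ_
  ; ≤-refl  = b≤b
  ; ≤-trans = tr }
  where
  tr : ∀ {x y z} → x ≤ᵇ y → y ≤ᵇ z → x ≤ᵇ z
  tr f≤t b≤b = f≤t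
  tr b≤b q   = q

[_,𝟚] : Pre → Pre
[ A ,𝟚] = record
  { Carrier = Mono A 𝟚
  ; _≤_     = λ V W → ∀ a → fun V a ≤ᵇ fun W a
  ; ≤-refl  = λ a → b≤b
  ; ≤-trans = λ p q a → Pre.≤-trans 𝟚 (p a) (q a) }

[_,𝟚]₁ : ∀ {A B} → Mono A B → Mono [ B ,𝟚] [ A ,𝟚]
[ f ,𝟚]₁ = record { fun = λ V → V ∘M f ; mono = λ p a → p (fun f a) }

-- Monotone relations: a relation from X to Y is a monotone map
-- Y^op × X → 2, rendered as a proposition-valued family R y x which is
-- antitone in y and monotone in x.

record Rel (X Y : Pre) : Set₁ where
  field
    rel  : ∣ Y ∣ → ∣ X ∣ → Set
    rmon : ∀ {y y' x x'} → Y ⊢ y' ≤ y → X ⊢ x ≤ x' → rel y x → rel y' x'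
open Rel public

_≤R_ : ∀ {X Y} → Rel X Y → Rel X Y → Set
R ≤R S = ∀ y x → rel R y x → rel S y x

_≃R_ : ∀ {X Y} → Rel X Y → Rel X Y → Set
R ≃R S = (R ≤R S) × (S ≤R R)

_·_ : ∀ {X Y Z} → Rel Y Z → Rel X Y → Rel X Z
_·_ {Y = Y} S R = record
  { rel  = λ z x → Σ ∣ Y ∣ (λ y → rel R y x × rel S z y)
  ; rmon = λ pz px (y , r , s) →
      y , rmon R (Pre.≤-refl Y) px r , rmon S pz (Pre.≤-refl Y) s }

idR : (X : Pre) → Rel X X
idR X = record
  { rel  = λ y x → X ⊢ y ≤ x
  ; rmon = λ p q r → Pre.≤-trans X p (Pre.≤-trans X r q) }

_⋄ : ∀ {X Y} → Mono X Y → Rel X Y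
_⋄ {Y = Y} h = record
  { rel  = λ y x → Y ⊢ y ≤ fun h x
  ; rmon = λ p q r → Pre.≤-trans Y p (Pre.≤-trans Y r (mono h q)) }

_^⋄ : ∀ {X Y} → Mono X Y → Rel Y X
_^⋄ {Y = Y} h = record
  { rel  = λ x y → Y ⊢ fun h x ≤ y
  ; rmon = λ p q r → Pre.≤-trans Y (mono h p) (Pre.≤-trans Y r q) }

∋ : (A : Pre) → Rel [ A ,𝟚] (op A)
∋ A = record
  { rel  = λ a V → fun V a ≡ true
  ; rmon = λ {a} {a'} {V} {V'} p q r → up (Pre.≤-trans 𝟚 (mono V p) (q a')) r }
  where
  up : ∀ {b b'} → b ≤ᵇ b' → b ≡ true → b' ≡ true
  up b≤b e = e
  up f≤t ()

record Functor : Set₁ where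
  field
    F₀    : Pre → Pre
    F₁    : ∀ {X Y} → Mono X Y → Mono (F₀ X) (F₀ Y)
    -- maps are equal when pointwise equal (as in Set)
    F-resp : ∀ {X Y} (f g : Mono X Y) → (∀ x → fun f x ≡ fun g x) →
             ∀ x → fun (F₁ f) x ≡ fun (F₁ g) x
    F-id  : ∀ {X} x → fun (F₁ (idM X)) x ≡ x
    F-∘   : ∀ {X Y Z} (g : Mono Y Z) (f : Mono X Y) x →
            fun (F₁ (g ∘M f)) x ≡ fun (F₁ g) (fun (F₁ f) x)
open Functor public

LocallyMonotone : Functor → Set₁
LocallyMonotone T = ∀ {X Y} (f g : Mono X Y) → f ≤M g → F₁ T f ≤M F₁ T g

LaxSquare : ∀ {P A B C} → Mono P A → Mono P B → Mono A C → Mono B C → Set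
LaxSquare p₀ p₁ f g = (f ∘M p₀) ≤M (g ∘M p₁)

Exact : ∀ {P A B C} → Mono P A → Mono P B → Mono A C → Mono B C → Set
Exact {P} {A} {B} {C} p₀ p₁ f g =
  ∀ a b →
    (C ⊢ fun f a ≤ fun g b → Σ ∣ P ∣ (λ w → (A ⊢ a ≤ fun p₀ w) × (B ⊢ fun p₁ w ≤ b)))
  × (Σ ∣ P ∣ (λ w → (A ⊢ a ≤ fun p₀ w) × (B ⊢ fun p₁ w ≤ b)) → C ⊢ fun f a ≤ fun g b)

BeckChevalley : Functor → Set₁
BeckChevalley T =
  ∀ {P A B C} (p₀ : Mono P A) (p₁ : Mono P B) (f : Mono A C) (g : Mono B C) →
  LaxSquare p₀ p₁ f g → Exact p₀ p₁ f g →
  Exact (F₁ T p₀) (F₁ T p₁) (F₁ T f) (F₁ T g)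

record Lifting (T : Functor) : Set₁ where
  field
    act      : ∀ {X Y} → Rel X Y → Rel (F₀ T X) (F₀ T Y)
    act-mono : ∀ {X Y} {R S : Rel X Y} → R ≤R S → act R ≤R act S
    act-id   : ∀ {X} → act (idR X) ≃R idR (F₀ T X)
    act-·    : ∀ {X Y Z} (S : Rel Y Z) (R : Rel X Y) → act (S · R) ≃R (act S · act R)
    act-⋄    : ∀ {X Y} (h : Mono X Y) → act (h ⋄) ≃R (F₁ T h ⋄)
open Lifting public

module Submission where

-- The membership relations ∋_A are natural in A: for every monotone f : A → B
--
--     ∋_A · [f,2]_⋄  =  (f^op)^⋄ · ∋_B        (relations [B,2] ⇸ A^op).
--
-- Both sides relate a ∈ A and W ∈ [B,2] exactly when W(f a) holds: on the
-- left via the witness V = W ∘ f, on the right via the witness b = f a.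
-- This equation lives in Rel(Pre) itself and needs nothing about T.  The
-- corollary follows because a lifting T̄ is a 2-functor: it preserves
-- composition up to ≃R and is monotone on 2-cells, hence carries every
-- commuting square of relations to a commuting square.

open import Defs
open import Data.Bool.Base using (true; f≤t; b≤b) renaming (_≤_ to _≤ᵇ_)
open import Data.Product using (_,_; proj₁; proj₂)
open import Relation.Binary.PropositionalEquality using (_≡_)

module _ {T : Functor} (L : Lifting T) where

  act-square : ∀ {X Y Y' Z} {R : Rel X Y} {S : Rel Y Z} {R' : Rel X Y'} {S' : Rel Y' Z} →
    (S · R) ≃R (S' · R') → (act L S · act L R) ≃R (act L S' · act L R')
  act-square {R = R} {S} {R'} {S'} (to , from) =
      (λ z x r → proj₁ split' z x (act-mono L to z x (proj₂ split z x r)))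
    , (λ z x r → proj₁ split z x (act-mono L from z x (proj₂ split' z x r)))
    where
    split : act L (S · R) ≃R (act L S · act L R)
    split = act-· L S R
    split' : act L (S' · R') ≃R (act L S' · act L R')
    split' = act-· L S' R'

true-upward : ∀ {b b'} → b ≤ᵇ b' → b ≡ true → b' ≡ true
true-upward b≤b e = e
true-upward f≤t ()

∋-natural : ∀ {A B : Pre} (f : Mono A B) →
  (∋ A · ([ f ,𝟚]₁ ⋄)) ≃R ((opM f ^⋄) · ∋ B)
∋-natural {A} {B} f = to , from
  where
  to : (∋ A · ([ f ,𝟚]₁ ⋄)) ≤R ((opM f ^⋄) · ∋ B)
  to a W (V , V≤Wf , Va) = fun f a , true-upward (V≤Wf a) Va , Pre.≤-refl B
  from : ((opM f ^⋄) · ∋ B) ≤R (∋ A · ([ f ,𝟚]₁ ⋄))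
  from a W (b , Wb , fa≤b) =
    W ∘M f , (λ _ → Pre.≤-refl 𝟚) , true-upward (mono W fa≤b) Wb

corollary7p2 : (T : Functor) → LocallyMonotone T → BeckChevalley T →
    (L : Lifting T) → ∀ {A B : Pre} (f : Mono A B) →
    (act L (∋ A) · act L ([ f ,𝟚]₁ ⋄)) ≃R (act L (opM f ^⋄) · act L (∋ B))
corollary7p2 T _ _ L f = act-square L (∋-natural f)
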